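{- Let $p$ be an odd prime and $\psi_p:GL_2(\mathbb{Z}/p\mathbb{Z})\to\{\pm1\}$, $\psi_p(\sigma)=\left(\frac{\det\sigma}{p}\right)$. For $r\in\mathbb{Z}$ and $s=\pm1$ let $\psi_p^{ -1}(s)_r=\{\sigma\in GL_2(\mathbb{Z}/p\mathbb{Z}):\psi_p(\sigma)=s,\ \mathrm{tr}\,\sigma\equiv r\bmod p\}$. Then \[ |\psi_p^{ -1}(1)_r|-|\psi_p^{ -1}(-1)_r|=\begin{cases}\left(\frac{ -1}{p}\right)p(p-1)&\text{if }p\mid r,\\-\left(\frac{ -1}{p}\right)p&\text{if }p\nmid r.\end{cases} \]
   Context: $\left(\frac{\cdot}{p}\right)$ is the Legendre symbol. -}

module Defs where

open import Data.Nat as ℕ using (ℕ)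
open import Data.Nat.Divisibility as ℕD using ()
open import Data.Integer as ℤ using (ℤ; +_; -_; _-_; _*_; _+_; ∣_∣)
open import Data.Fin using (Fin; toℕ)
open import Data.List using (List; []; _∷_; allFin; filter; length; concatMap)
open import Data.Bool.ListAction using (any)
open import Data.Bool using (Bool; true; false; if_then_else_; not; _∧_; T?)
open import Data.Product using (_×_; _,_)
open import Relation.Nullary using (does)
open import Relation.Unary using (Decidable)
open import Relation.Binary.PropositionalEquality using (_≡_)

-- Z/pZ is represented by Fin p (canonical residues 0..p-1), read into ℤ.
ι : {p : ℕ} → Fin p → ℤ
ι x = + (toℕ x)

_∣ᵇ_ : ℕ → ℤ → Bool
p ∣ᵇ x = does (p ℕD.∣? ∣ x ∣)

legendre : ℤ → ℕ → ℤ
legendre a p =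
  if p ∣ᵇ a then + 0
  else if any (λ (y : Fin p) → p ∣ᵇ (ι y * ι y - a)) (allFin p) then + 1
  else - (+ 1)

-- A 2x2 matrix over Z/pZ, entries (a b ; c d).
M₂ : ℕ → Set
M₂ p = Fin p × Fin p × Fin p × Fin p

allM₂ : (p : ℕ) → List (M₂ p)
allM₂ p = concatMap (λ a → concatMap (λ b → concatMap (λ c → concatMap (λ d →
  (a , b , c , d) ∷ []) (allFin p)) (allFin p)) (allFin p)) (allFin p)

-- determinant and trace, lifted to ℤ (to be read mod p)
det : {p : ℕ} → M₂ p → ℤ
det (a , b , c , d) = ι a * ι d - ι b * ι c

tr : {p : ℕ} → M₂ p → ℤ
tr (a , b , c , d) = ι a + ι d

-- σ ∈ GL₂(Z/pZ) iff det σ is a unit mod p, i.e. (p prime) p ∤ det σ.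
inGL₂ᵇ : {p : ℕ} → M₂ p → Bool
inGL₂ᵇ {p} σ = not (p ∣ᵇ det σ)

ψ : (p : ℕ) → M₂ p → ℤ
ψ p σ = legendre (det σ) p

fiberCount : (p : ℕ) → ℤ → ℤ → ℕ
fiberCount p s r = length (filter (λ σ → T?
    (inGL₂ᵇ σ ∧ does (ψ p σ ℤ.≟ s) ∧ (p ∣ᵇ (tr σ - r)))) (allM₂ p))

module Submission where

-- Since (det σ/p) ∈ {0, ±1} vanishes exactly off GL₂, the difference of the two counts is the
-- Legendre sum S(r) = Σ_{a + d ≡ r} ((ad - bc)/p) over all 2 × 2 matrices.  Writing the symbol as
-- (x/p) = #{y : y² ≡ x} - 1, it depends only on x mod p and sums to 0 over Z/p.  Summing S(r) over
-- d = r - a, then over c (for b ≢ 0 the map c ↦ K - bc permutes Z/p, contributing 0), then over b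
-- gives S(r) = p J(r) with J(r) = Σ_a ((a (r - a))/p).  If p ∣ r then a (r - a) ≡ -a², so
-- J(r) = (p - 1)(-1/p); if p ∤ r, writing the square roots of a (r - a) as y = a k shows
-- J(r) = 1 - #{k : k² ≡ -1} = -(-1/p).

open import Data.Nat as ℕ using (ℕ; zero; suc; NonZero)
import Data.Nat.Properties as ℕP
import Data.Nat.Divisibility as ℕD
open import Data.Nat.Divisibility using (_∣_)
open import Data.Nat.Primality using (Prime; euclidsLemma; prime⇒nonZero; prime⇒nonTrivial)
open import Data.Integer as ℤ using (ℤ; +_; -_; _-_; _*_; _+_; ∣_∣)
import Data.Integer.Properties as ℤP
open import Data.Integer.Divisibility.Signed using (∣ᵤ⇒∣; ∣⇒∣ᵤ)
import Data.Integer.Divisibility.Signed as ℤD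
open import Data.Integer.DivMod using (_%ℕ_; _/ℕ_; n%ℕd<d; a≡a%ℕn+[a/ℕn]*n)
open import Data.Integer.Tactic.RingSolver using (solve-∀)
open import Data.Fin as Fin using (Fin; zero; suc; toℕ; fromℕ<; punchOut)
import Data.Fin.Properties as FinP
open import Data.Fin.Permutation using (permutation)
open import Data.List using (List; []; _∷_; _++_; filter; length; concatMap; tabulate; allFin)
open import Data.Bool.ListAction using (any)
open import Data.List.Relation.Unary.Any using (satisfied)
open import Data.List.Relation.Unary.Any.Properties using (any⁺; any⁻; tabulate⁺)
import Data.List.Properties as ListP
open import Data.Bool using (Bool; true; false; if_then_else_; not; _∧_; T; T?)
open import Data.Product using (∃; _×_; _,_; proj₁; proj₂)
open import Data.Sum using (_⊎_; inj₁; inj₂; [_,_]′)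
open import Function using (_∘_; id; Injective)
open import Relation.Nullary using (¬_; Dec; yes; no; does; contradiction)
open import Relation.Nullary.Decidable using (map′)
open import Relation.Binary.PropositionalEquality
open import Defs hiding (ι)
import Defs

open import Algebra.Properties.Semiring.Sum ℤP.+-*-semiring
  using (sum; sum-syntax; ∑-distrib-+; ∑-comm; ∑-permute; sum-remove; sum-cong-≗; sum-replicate-zero; *-distribˡ-sum; *-distribʳ-sum)

∑-cong : ∀ {n} {f g : Fin n → ℤ} → (∀ i → f i ≡ g i) → sum f ≡ sum g
∑-cong {n} {f} {g} = sum-cong-≗ {n} {f} {g}

∑-const : ∀ n (c : ℤ) → (∑[ i < n ] c) ≡ + n * c
∑-const zero    c = refl
∑-const (suc n) c = trans (cong (_+_ c) (∑-const n c)) (lemma c (+ n))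
  where
  lemma : ∀ c m → c + m * c ≡ (+ 1 + m) * c
  lemma = solve-∀

∑-distrib-- : ∀ {n} (f g : Fin n → ℤ) → (∑[ i < n ] (f i - g i)) ≡ sum f - sum g
∑-distrib-- {zero}  f g = refl
∑-distrib-- {suc n} f g =
  trans (cong (_+_ (f zero - g zero)) (∑-distrib-- (f ∘ suc) (g ∘ suc))) (regroup (f zero) (g zero) _ _)
  where regroup : ∀ a b c d → (a - b) + (c - d) ≡ (a + c) - (b + d)
        regroup = solve-∀

∑-single : ∀ {n} (f : Fin n → ℤ) (i : Fin n) → (∀ j → j ≢ i → f j ≡ + 0) → (∑[ j < n ] f j) ≡ f i
∑-single {suc n} f i vanish = begin
  sum f                                     ≡⟨ sum-remove {i = i} f ⟩
  f i + sum {n} (λ j → f (Fin.punchIn i j)) ≡⟨ cong (_+_ (f i)) (∑-cong (λ j → vanish _ (FinP.punchInᵢ≢i i j))) ⟩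
  f i + sum {n} (λ _ → + 0)                 ≡⟨ cong (_+_ (f i)) (sum-replicate-zero n) ⟩
  f i + + 0                                 ≡⟨ ℤP.+-identityʳ (f i) ⟩
  f i                                       ∎
  where open ≡-Reasoning

-- Pigeonhole: an injective endomap of Fin n is onto.  If y were missed, f would
-- inject Fin n into the n - 1 remaining points.
injective⇒surjective : ∀ {n} (f : Fin n → Fin n) → Injective _≡_ _≡_ f → ∀ y → ∃ λ x → f x ≡ y
injective⇒surjective {suc n} f f-inj y with FinP.any? (λ x → f x Fin.≟ y)
... | yes hit = hit
... | no miss = contradiction (FinP.injective⇒≤ squeezed-inj) ℕP.1+n≰n
  where
  y≢f : ∀ x → y ≢ f x
  y≢f x y≡fx = miss (x , sym y≡fx)
  squeezed : Fin (suc n) → Fin n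
  squeezed x = punchOut (y≢f x)
  squeezed-inj : Injective _≡_ _≡_ squeezed
  squeezed-inj {x} {x′} eq = f-inj (FinP.punchOut-injective (y≢f x) (y≢f x′) eq)

∑-reindex : ∀ {n} (f : Fin n → Fin n) → Injective _≡_ _≡_ f → (g : Fin n → ℤ) →
  (∑[ i < n ] g (f i)) ≡ (∑[ i < n ] g i)
∑-reindex {n} f f-inj g = sym (∑-permute g π)
  where
  f⁻¹ : Fin n → Fin n
  f⁻¹ y = proj₁ (injective⇒surjective f f-inj y)
  π = permutation f f⁻¹ (λ y → proj₂ (injective⇒surjective f f-inj y))
                         (λ x → f-inj (proj₂ (injective⇒surjective f f-inj (f x))))

∑⁴ : ∀ n → (Fin n → Fin n → Fin n → Fin n → ℤ) → ℤ
∑⁴ n f = ∑[ a < n ] ∑[ b < n ] ∑[ c < n ] ∑[ d < n ] f a b c d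

∑⁴-cong : ∀ {n} {f g : Fin n → Fin n → Fin n → Fin n → ℤ} → (∀ a b c d → f a b c d ≡ g a b c d) → ∑⁴ n f ≡ ∑⁴ n g
∑⁴-cong {n} eq = ∑-cong {n} λ a → ∑-cong {n} λ b → ∑-cong {n} λ c → ∑-cong {n} λ d → eq a b c d

∑⁴-distrib-- : ∀ {n} (f g : Fin n → Fin n → Fin n → Fin n → ℤ) →
  ∑⁴ n (λ a b c d → f a b c d - g a b c d) ≡ ∑⁴ n f - ∑⁴ n g
∑⁴-distrib-- {n} f g =
  trans (∑-cong {n} λ a → trans (∑-cong {n} λ b → trans (∑-cong {n} λ c → ∑-distrib-- (f a b c) (g a b c))
                                                         (∑-distrib-- (F₃ f a b) (F₃ g a b)))
                              (∑-distrib-- (F₂ f a) (F₂ g a)))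
        (∑-distrib-- (F₁ f) (F₁ g))
  where
  F₃ : (Fin n → Fin n → Fin n → Fin n → ℤ) → Fin n → Fin n → Fin n → ℤ
  F₃ h a b c = ∑[ d < n ] h a b c d
  F₂ : (Fin n → Fin n → Fin n → Fin n → ℤ) → Fin n → Fin n → ℤ
  F₂ h a b = ∑[ c < n ] F₃ h a b c
  F₁ : (Fin n → Fin n → Fin n → Fin n → ℤ) → Fin n → ℤ
  F₁ h a = ∑[ b < n ] F₂ h a b

⟦_⟧ : Bool → ℤ
⟦ b ⟧ = if b then + 1 else + 0

count : ∀ {A : Set} → (A → Bool) → List A → ℤ
count P xs = + length (filter (T? ∘ P) xs)

count-concatMap : ∀ {A B : Set} (P : B → Bool) {n} (f : Fin n → A) (g : A → List B) →
  count P (concatMap g (tabulate f)) ≡ (∑[ i < n ] count P (g (f i)))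
count-concatMap P {zero}  f g = refl
count-concatMap P {suc n} f g = begin
  + length (filter (T? ∘ P) (first ++ rest))                   ≡⟨ cong (+_ ∘ length) (ListP.filter-++ (T? ∘ P) first rest) ⟩
  + length (filter (T? ∘ P) first ++ filter (T? ∘ P) rest)     ≡⟨ cong +_ (ListP.length-++ (filter (T? ∘ P) first)) ⟩
  + (length (filter (T? ∘ P) first) ℕ.+ length (filter (T? ∘ P) rest))
                                                               ≡⟨ ℤP.pos-+ (length (filter (T? ∘ P) first)) _ ⟩
  count P first + count P rest                                 ≡⟨ cong (_+_ (count P first)) (count-concatMap P (f ∘ suc) g) ⟩
  (∑[ i < suc n ] count P (g (f i)))                           ∎
  where
  open ≡-Reasoning
  first = g (f zero)
  rest = concatMap g (tabulate (f ∘ suc))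

count-singleton : ∀ {A : Set} (P : A → Bool) x → count P (x ∷ []) ≡ ⟦ P x ⟧
count-singleton P x with P x
... | true  = refl
... | false = refl

module Residues (p : ℕ) .{{_ : NonZero p}} where

  -- The canonical lift Fin p → ℤ, with the modulus fixed (so that sums over
  -- residues determine their index set).
  ι : Fin p → ℤ
  ι = Defs.ι

  infix 4 p∣_
  p∣_ : ℤ → Set
  p∣ x = + p ℤD.∣ x

  -- Congruence modulo p (a record, so that x and y can be inferred).
  infix 4 _≋_
  record _≋_ (x y : ℤ) : Set where
    constructor ≋-by
    field difference : p∣ x - y
  open _≋_

  ∣-by : ∀ {x y} → x ≡ y → p∣ x → p∣ y
  ∣-by = subst p∣_

  divisible? : ∀ x → Dec (p∣ x)
  divisible? x = map′ ∣ᵤ⇒∣ ∣⇒∣ᵤ (p ℕD.∣? ∣ x ∣)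

  opaque
    δ : ℤ → ℤ
    δ x = if p ∣ᵇ x then + 1 else + 0

  ∣ᵇ-true : ∀ {x} → p∣ x → p ∣ᵇ x ≡ true
  ∣ᵇ-true {x} p∣x with p ℕD.∣? ∣ x ∣
  ... | yes _  = refl
  ... | no p∤x = contradiction (∣⇒∣ᵤ p∣x) p∤x

  ∣ᵇ-false : ∀ {x} → ¬ p∣ x → p ∣ᵇ x ≡ false
  ∣ᵇ-false {x} p∤x with p ℕD.∣? ∣ x ∣
  ... | yes p∣x = contradiction (∣ᵤ⇒∣ p∣x) p∤x
  ... | no _    = refl

  ∣ᵇ-sound : ∀ {x} → T (p ∣ᵇ x) → p∣ x
  ∣ᵇ-sound {x} holds with p ℕD.∣? ∣ x ∣
  ... | yes p∣x = ∣ᵤ⇒∣ p∣x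

  opaque
    unfolding δ

    δ-yes : ∀ {x} → p∣ x → δ x ≡ + 1
    δ-yes p∣x rewrite ∣ᵇ-true p∣x = refl

    δ-no : ∀ {x} → ¬ p∣ x → δ x ≡ + 0
    δ-no p∤x rewrite ∣ᵇ-false p∤x = refl

    δ≡⟦∣ᵇ⟧ : ∀ x → δ x ≡ ⟦ p ∣ᵇ x ⟧
    δ≡⟦∣ᵇ⟧ x = refl

  Respects≋ : (ℤ → ℤ) → Set
  Respects≋ h = ∀ {x y} → x ≋ y → h x ≡ h y

  δ-respects : Respects≋ δ
  δ-respects {x} {y} (≋-by p∣x-y) with divisible? x
  ... | yes p∣x = trans (δ-yes p∣x) (sym (δ-yes (∣-by (shift x y) (ℤD.∣m∣n⇒∣m-n p∣x p∣x-y))))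
    where shift : ∀ x y → x - (x - y) ≡ y
          shift = solve-∀
  ... | no p∤x  = trans (δ-no p∤x) (sym (δ-no λ p∣y → p∤x (∣-by (shift x y) (ℤD.∣m∣n⇒∣m+n p∣x-y p∣y))))
    where shift : ∀ x y → x - y + y ≡ x
          shift = solve-∀

  δ-neg : ∀ x → δ (- x) ≡ δ x
  δ-neg x with divisible? x
  ... | yes p∣x = trans (δ-yes (ℤD.∣m⇒∣-m p∣x)) (sym (δ-yes p∣x))
  ... | no p∤x  = trans (δ-no (p∤x ∘ ∣-by (ℤP.neg-involutive x) ∘ ℤD.∣m⇒∣-m)) (sym (δ-no p∤x))

  δ-swap : ∀ a b → δ (a - b) ≡ δ (b - a)
  δ-swap a b = trans (cong δ (flip a b)) (δ-neg (b - a))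
    where flip : ∀ a b → a - b ≡ - (b - a)
          flip = solve-∀

  small-multiple≡0 : ∀ {n} → p ∣ n → n ℕ.< p → n ≡ 0
  small-multiple≡0 {zero}  _   _   = refl
  small-multiple≡0 {suc n} p∣n n<p = contradiction p∣n (ℕD.>⇒∤ n<p)

  ι-injective : ∀ (z w : Fin p) → ι z ≋ ι w → z ≡ w
  ι-injective z w (≋-by p∣z-w) = FinP.toℕ-injective (ℤP.+-injective
    (ℤP.i-j≡0⇒i≡j (ι z) (ι w) (ℤP.∣i∣≡0⇒i≡0 (small-multiple≡0 (∣⇒∣ᵤ p∣z-w) difference<p))))
    where
    difference<p : ∣ ι z - ι w ∣ ℕ.< p
    difference<p = subst (ℕ._< p) (cong ∣_∣ (sym (ℤP.[+m]-[+n]≡m⊖n (toℕ z) (toℕ w))))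
      (ℕP.≤-<-trans (ℤP.∣m⊝n∣≤m⊔n (toℕ z) (toℕ w)) (ℕP.⊔-pres-<m (FinP.toℕ<n z) (FinP.toℕ<n w)))

  residue : ∀ c → ∃ λ (z : Fin p) → c ≋ ι z
  residue c = fromℕ< (n%ℕd<d c p) , ≋-by (ℤD.divides (c /ℕ p) c-remainder)
    where
    c-remainder : c - ι (fromℕ< (n%ℕd<d c p)) ≡ (c /ℕ p) * + p
    c-remainder rewrite FinP.toℕ-fromℕ< (n%ℕd<d c p) =
      subst (λ c′ → c′ - + (c %ℕ p) ≡ (c /ℕ p) * + p) (sym (a≡a%ℕn+[a/ℕn]*n c p)) (cancel (+ (c %ℕ p)) _)
      where cancel : ∀ r q → r + q - r ≡ q
            cancel = solve-∀

  ≋-sym : ∀ {x y} → x ≋ y → y ≋ x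
  ≋-sym {x} {y} (≋-by p∣x-y) = ≋-by (∣-by (flip x y) (ℤD.∣m⇒∣-m p∣x-y))
    where flip : ∀ x y → - (x - y) ≡ y - x
          flip = solve-∀

  ≋-trans : ∀ {x y z} → x ≋ y → y ≋ z → x ≋ z
  ≋-trans {x} {y} {z} (≋-by p∣x-y) (≋-by p∣y-z) = ≋-by (∣-by (telescope x y z) (ℤD.∣m∣n⇒∣m+n p∣x-y p∣y-z))
    where telescope : ∀ x y z → (x - y) + (y - z) ≡ x - z
          telescope = solve-∀

  ≋-shift : ∀ {u u′} c → u ≋ u′ → u - c ≋ u′ - c
  ≋-shift {u} {u′} c (≋-by p∣u-u′) = ≋-by (∣-by (cancel u u′ c) p∣u-u′)
    where cancel : ∀ u u′ c → u - u′ ≡ (u - c) - (u′ - c)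
          cancel = solve-∀

  ∑-δ-point : ∀ (h : ℤ → ℤ) → Respects≋ h → ∀ c → (∑[ z < p ] (δ (ι z - c) * h (ι z))) ≡ h c
  ∑-δ-point h h-resp c = trans (∑-single _ z₀ off-z₀) (begin
      δ (ι z₀ - c) * h (ι z₀) ≡⟨ cong₂ _*_ (δ-yes (difference (≋-sym c≋z₀))) (h-resp (≋-sym c≋z₀)) ⟩
      + 1 * h c               ≡⟨ ℤP.*-identityˡ (h c) ⟩
      h c                     ∎)
    where
    open ≡-Reasoning
    z₀ = proj₁ (residue c)
    c≋z₀ = proj₂ (residue c)
    off-z₀ : ∀ z → z ≢ z₀ → δ (ι z - c) * h (ι z) ≡ + 0
    off-z₀ z z≢z₀ = trans (cong (_* h (ι z)) (δ-no (z≢z₀ ∘ ι-injective z z₀ ∘ λ p∣z-c → ≋-trans (≋-by p∣z-c) c≋z₀)))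
                          (ℤP.*-zeroˡ (h (ι z)))

  ∑-δ : ∀ c → (∑[ z < p ] δ (ι z - c)) ≡ + 1
  ∑-δ c = trans (∑-cong {p} (λ z → sym (ℤP.*-identityʳ (δ (ι z - c))))) (∑-δ-point (λ _ → + 1) (λ _ → refl) c)

  ∑-δ₀ : (∑[ z < p ] δ (ι z)) ≡ + 1
  ∑-δ₀ = trans (∑-cong {p} (λ z → cong δ (sym (ℤP.+-identityʳ (ι z))))) (∑-δ (+ 0))

  ∑-reindex≋ : ∀ (e : ℤ → ℤ) → (∀ x y → e x ≋ e y → x ≋ y) → ∀ (h : ℤ → ℤ) → Respects≋ h →
    (∑[ z < p ] h (e (ι z))) ≡ (∑[ z < p ] h (ι z))
  ∑-reindex≋ e e-inj h h-resp =
    trans (∑-cong {p} (λ z → h-resp (proj₂ (residue (e (ι z)))))) (∑-reindex {p} f f-inj (h ∘ ι))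
    where
    f : Fin p → Fin p
    f z = proj₁ (residue (e (ι z)))
    f-inj : Injective _≡_ _≡_ f
    f-inj {z} {w} fz≡fw = ι-injective z w (e-inj (ι z) (ι w)
      (≋-trans (proj₂ (residue (e (ι z)))) (subst (λ v → ι v ≋ e (ι w)) (sym fz≡fw) (≋-sym (proj₂ (residue (e (ι w))))))))

module PrimeResidues (p : ℕ) (p-prime : Prime p) where

  instance
    p-nonZero : NonZero p
    p-nonZero = prime⇒nonZero p-prime

  open Residues p public

  euclid : ∀ {x y} → p∣ x * y → p∣ x ⊎ p∣ y
  euclid {x} {y} p∣xy with euclidsLemma ∣ x ∣ ∣ y ∣ p-prime (subst (p ∣_) (ℤP.abs-* x y) (∣⇒∣ᵤ p∣xy))
  ... | inj₁ p∣x = inj₁ (∣ᵤ⇒∣ p∣x)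
  ... | inj₂ p∣y = inj₂ (∣ᵤ⇒∣ p∣y)

  unit-cancel : ∀ {m x} → ¬ (p∣ m) → p∣ m * x → p∣ x
  unit-cancel p∤m p∣mx with euclid p∣mx
  ... | inj₁ p∣m = contradiction p∣m p∤m
  ... | inj₂ p∣x = p∣x

  δ-unit : ∀ {m} x → ¬ (p∣ m) → δ (m * x) ≡ δ x
  δ-unit {m} x p∤m with divisible? x
  ... | yes p∣x = trans (δ-yes (ℤD.∣n⇒∣m*n m p∣x)) (sym (δ-yes p∣x))
  ... | no p∤x  = trans (δ-no (p∤x ∘ unit-cancel p∤m)) (sym (δ-no p∤x))

  unit-injective : ∀ {m} → ¬ (p∣ m) → ∀ x y → m * x ≋ m * y → x ≋ y
  unit-injective {m} p∤m x y (≋-by p∣mx-my) = ≋-by (unit-cancel p∤m (∣-by (factor m x y) p∣mx-my))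
    where factor : ∀ m x y → m * x - m * y ≡ m * (x - y)
          factor = solve-∀

  δ-square : ∀ x → δ (x * x) ≡ δ x
  δ-square x with divisible? x
  ... | yes p∣x = trans (δ-yes (ℤD.∣m⇒∣m*n x p∣x)) (sym (δ-yes p∣x))
  ... | no p∤x  = trans (δ-no (p∤x ∘ [ id , id ]′ ∘ euclid)) (sym (δ-no p∤x))

  δ-product : ∀ a b → ¬ (p∣ a × p∣ b) → δ (a * b) ≡ δ a + δ b
  δ-product a b not-both with divisible? a | divisible? b
  ... | yes p∣a | yes p∣b = contradiction (p∣a , p∣b) not-both
  ... | yes p∣a | no p∤b  = trans (δ-yes (ℤD.∣m⇒∣m*n b p∣a)) (sym (cong₂ _+_ (δ-yes p∣a) (δ-no p∤b)))
  ... | no p∤a  | yes p∣b = trans (δ-yes (ℤD.∣n⇒∣m*n a p∣b)) (sym (cong₂ _+_ (δ-no p∤a) (δ-yes p∣b)))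
  ... | no p∤a  | no p∤b  = trans (δ-no ([ p∤a , p∤b ]′ ∘ euclid)) (sym (cong₂ _+_ (δ-no p∤a) (δ-no p∤b)))

module SquareRoots (p : ℕ) (p-prime : Prime p) (p≢2 : p ≢ 2) where

  open PrimeResidues p p-prime public

  roots : ℤ → ℤ
  roots x = ∑[ y < p ] δ (ι y * ι y - x)

  square-minus-respects : ∀ {u u′} x → u ≋ u′ → u * u - x ≋ u′ * u′ - x
  square-minus-respects {u} {u′} x (≋-by p∣u-u′) = ≋-by (∣-by (factor u u′ x) (ℤD.∣m⇒∣m*n (u + u′) p∣u-u′))
    where factor : ∀ u u′ x → (u - u′) * (u + u′) ≡ (u * u - x) - (u′ * u′ - x)
          factor = solve-∀

  roots-respects : Respects≋ roots
  roots-respects {x} {x′} (≋-by p∣x-x′) = ∑-cong {p} λ y →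
    δ-respects (≋-by (∣-by (shift (ι y * ι y) x x′) (ℤD.∣m⇒∣-m p∣x-x′)))
    where shift : ∀ s x x′ → - (x - x′) ≡ (s - x) - (s - x′)
          shift = solve-∀

  roots-of-zero : ∀ {x} → p∣ x → roots x ≡ + 1
  roots-of-zero {x} p∣x = trans (∑-cong {p} root-at-zero) (∑-δ (+ 0))
    where
    root-at-zero : ∀ y → δ (ι y * ι y - x) ≡ δ (ι y - + 0)
    root-at-zero y = begin
      δ (ι y * ι y - x)   ≡⟨ δ-respects (≋-by (∣-by (shift (ι y * ι y) x) (ℤD.∣m⇒∣-m p∣x))) ⟩
      δ (ι y * ι y)       ≡⟨ δ-square (ι y) ⟩
      δ (ι y)             ≡⟨ cong δ (sym (ℤP.+-identityʳ (ι y))) ⟩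
      δ (ι y - + 0)       ∎
      where
      open ≡-Reasoning
      shift : ∀ s x → - x ≡ (s - x) - s
      shift = solve-∀

  -- Since p is odd, p cannot divide both u - v and u + v when p ∤ v.
  not-both : ∀ u {v} → ¬ p∣ v → ¬ (p∣ u - v × p∣ u - - v)
  not-both u {v} p∤v (p∣u-v , p∣u+v) with euclid {+ 2} {v} (∣-by (twice u v) (ℤD.∣m∣n⇒∣m-n p∣u+v p∣u-v))
    where twice : ∀ u v → (u - - v) - (u - v) ≡ + 2 * v
          twice = solve-∀
  ... | inj₁ p∣2 = p≢2 (ℕP.≤-antisym (ℕD.∣⇒≤ (∣⇒∣ᵤ p∣2)) (ℕ.nonTrivial⇒n>1 p {{prime⇒nonTrivial p-prime}}))
  ... | inj₂ p∣v = p∤v p∣v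

  roots-of-square : ∀ {x v} → ¬ p∣ x → p∣ v * v - x → roots x ≡ + 2
  roots-of-square {x} {v} p∤x p∣v²-x = begin
    (∑[ u < p ] δ (ι u * ι u - x))                          ≡⟨ ∑-cong {p} two-roots ⟩
    (∑[ u < p ] (δ (ι u - v) + δ (ι u - - v)))              ≡⟨ ∑-distrib-+ (λ u → δ (ι u - v)) (λ u → δ (ι u - - v)) ⟩
    (∑[ u < p ] δ (ι u - v)) + (∑[ u < p ] δ (ι u - - v))   ≡⟨ cong₂ _+_ (∑-δ v) (∑-δ (- v)) ⟩
    + 2                                                      ∎
    where
    open ≡-Reasoning
    p∤v : ¬ p∣ v
    p∤v p∣v = p∤x (∣-by (shift v x) (ℤD.∣m∣n⇒∣m-n (ℤD.∣m⇒∣m*n v p∣v) p∣v²-x))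
      where shift : ∀ v x → v * v - (v * v - x) ≡ x
            shift = solve-∀
    two-roots : ∀ u → δ (ι u * ι u - x) ≡ δ (ι u - v) + δ (ι u - - v)
    two-roots u = trans (δ-respects (≋-by (∣-by (factor (ι u) v x) p∣v²-x)))
                        (δ-product (ι u - v) (ι u - - v) (not-both (ι u) p∤v))
      where factor : ∀ u v x → v * v - x ≡ (u * u - x) - (u - v) * (u - - v)
            factor = solve-∀

  -- Whether y is a square root of x; the Legendre symbol searches for one.
  is-root : ℤ → Fin p → Bool
  is-root x y = p ∣ᵇ (Defs.ι y * Defs.ι y - x)

  roots-none : ∀ {x} → any (is-root x) (allFin p) ≡ false → roots x ≡ + 0
  roots-none {x} none = trans (∑-cong {p} no-root) (sum-replicate-zero p)
    where
    no-root : ∀ y → δ (ι y * ι y - x) ≡ + 0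
    no-root y = δ-no λ p∣y²-x → subst T none
      (any⁺ (is-root x) (tabulate⁺ y (subst T (sym (∣ᵇ-true p∣y²-x)) _)))

  legendre≡roots-1 : ∀ x → legendre x p ≡ roots x - + 1
  legendre≡roots-1 x with divisible? x
  ... | yes p∣x rewrite ∣ᵇ-true p∣x | roots-of-zero p∣x = refl
  ... | no p∤x rewrite ∣ᵇ-false p∤x with any (is-root x) (allFin p) in search
  ...   | false rewrite roots-none search = refl
  ...   | true  with satisfied (any⁻ (is-root x) (allFin p) (subst T (sym search) _))
  ...     | y , y-root rewrite roots-of-square {x} {ι y} p∤x (∣ᵇ-sound y-root) = refl

  legendre-respects : Respects≋ (λ x → legendre x p)
  legendre-respects {x} {x′} x≋x′ =
    trans (legendre≡roots-1 x) (trans (cong (_- + 1) (roots-respects x≋x′)) (sym (legendre≡roots-1 x′)))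

  -- Each y is a square root of exactly one residue: Σ_z #{y : y² ≡ z} = p.
  ∑-roots : (∑[ z < p ] roots (ι z)) ≡ + p
  ∑-roots = begin
    (∑[ z < p ] ∑[ y < p ] δ (ι y * ι y - ι z)) ≡⟨ ∑-comm (λ z y → δ (ι y * ι y - ι z)) ⟩
    (∑[ y < p ] ∑[ z < p ] δ (ι y * ι y - ι z)) ≡⟨ ∑-cong {p} (λ y → ∑-cong {p} (λ z → δ-swap (ι y * ι y) (ι z))) ⟩
    (∑[ y < p ] ∑[ z < p ] δ (ι z - ι y * ι y)) ≡⟨ ∑-cong {p} (λ y → ∑-δ (ι y * ι y)) ⟩
    (∑[ y < p ] (+ 1))                          ≡⟨ ∑-const p (+ 1) ⟩
    + p * + 1                                   ≡⟨ ℤP.*-identityʳ (+ p) ⟩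
    + p                                         ∎
    where open ≡-Reasoning

  -- Half of the units are squares: the Legendre symbol sums to zero over a full residue system.
  ∑-legendre≡0 : (∑[ z < p ] legendre (ι z) p) ≡ + 0
  ∑-legendre≡0 = begin
    (∑[ z < p ] legendre (ι z) p)           ≡⟨ ∑-cong {p} (λ z → legendre≡roots-1 (ι z)) ⟩
    (∑[ z < p ] (roots (ι z) - + 1))        ≡⟨ ∑-distrib-- (λ z → roots (ι z)) (λ _ → + 1) ⟩
    (∑[ z < p ] roots (ι z)) - (∑[ z < p ] (+ 1)) ≡⟨ cong₂ _-_ ∑-roots (∑-const p (+ 1)) ⟩
    + p - + p * + 1                         ≡⟨ cancel (+ p) ⟩
    + 0                                     ∎
    where
    open ≡-Reasoning
    cancel : ∀ n → n - n * + 1 ≡ + 0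
    cancel = solve-∀

  roots-rescale : ∀ {m} x → ¬ p∣ m → roots x ≡ (∑[ k < p ] δ ((m * ι k) * (m * ι k) - x))
  roots-rescale {m} x p∤m =
    sym (∑-reindex≋ (m *_) (unit-injective p∤m) (λ u → δ (u * u - x)) (δ-respects ∘ square-minus-respects x))

  legendre-of-zero : ∀ {x} → p∣ x → legendre x p ≡ + 0
  legendre-of-zero {x} p∣x = trans (legendre≡roots-1 x) (cong (_- + 1) (roots-of-zero p∣x))

  legendre-unit-square : ∀ {m} x → ¬ p∣ m → legendre (m * m * x) p ≡ legendre x p
  legendre-unit-square {m} x p∤m = begin
    legendre (m * m * x) p                                     ≡⟨ legendre≡roots-1 (m * m * x) ⟩
    roots (m * m * x) - + 1                                    ≡⟨ cong (_- + 1) (roots-rescale (m * m * x) p∤m) ⟩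
    (∑[ k < p ] δ ((m * ι k) * (m * ι k) - m * m * x)) - + 1   ≡⟨ cong (_- + 1) (∑-cong {p} cancel-m²) ⟩
    roots x - + 1                                              ≡⟨ legendre≡roots-1 x ⟨
    legendre x p                                               ∎
    where
    open ≡-Reasoning
    p∤m² : ¬ p∣ m * m
    p∤m² = p∤m ∘ [ id , id ]′ ∘ euclid
    factor : ∀ m k x → (m * k) * (m * k) - m * m * x ≡ (m * m) * (k * k - x)
    factor = solve-∀
    cancel-m² : ∀ k → δ ((m * ι k) * (m * ι k) - m * m * x) ≡ δ (ι k * ι k - x)
    cancel-m² k = trans (cong δ (factor m (ι k) x)) (δ-unit (ι k * ι k - x) p∤m²)

-- A matrix with (u = p ∣ det) and (q = det is a nonzero square) has Legendre symbol L below;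
-- it is counted in the +1 fibre minus the -1 fibre with total weight L (when its trace condition t holds).
fibre-weight : ∀ (u q t : Bool) → let L = if u then + 0 else if q then + 1 else - (+ 1) in
  ⟦ not u ∧ does (L ℤ.≟ + 1) ∧ t ⟧ - ⟦ not u ∧ does (L ℤ.≟ - (+ 1)) ∧ t ⟧ ≡ L * ⟦ t ⟧
fibre-weight true  q     t     = refl
fibre-weight false true  true  = refl
fibre-weight false true  false = refl
fibre-weight false false true  = refl
fibre-weight false false false = refl

module TraceSums (p : ℕ) (p-prime : Prime p) (p≢2 : p ≢ 2) where

  open SquareRoots p p-prime p≢2 public

  traceSum : ℤ → ℤ
  traceSum r = ∑⁴ p λ a b c d → legendre (ι a * ι d - ι b * ι c) p * δ (ι a + ι d - r)

  jacobsthal : ℤ → ℤ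
  jacobsthal r = ∑[ a < p ] legendre (ι a * (r - ι a)) p

  -- Summing over d with a + d ≡ r substitutes d = r - a.
  sum-over-d : ∀ r a b c →
    (∑[ d < p ] (legendre (ι a * ι d - ι b * ι c) p * δ (ι a + ι d - r))) ≡ legendre (ι a * (r - ι a) - ι b * ι c) p
  sum-over-d r a b c = trans (∑-cong {p} reorder) (∑-δ-point h h-respects (r - ι a))
    where
    h : ℤ → ℤ
    h u = legendre (ι a * u - ι b * ι c) p
    h-respects : Respects≋ h
    h-respects {u} {u′} (≋-by p∣u-u′) = legendre-respects (≋-by (∣-by (factor (ι a) u u′ (ι b * ι c)) (ℤD.∣n⇒∣m*n (ι a) p∣u-u′)))
      where factor : ∀ a u u′ s → a * (u - u′) ≡ (a * u - s) - (a * u′ - s)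
            factor = solve-∀
    shift : ∀ a d r → a + d - r ≡ d - (r - a)
    shift = solve-∀
    reorder : ∀ d → h (ι d) * δ (ι a + ι d - r) ≡ δ (ι d - (r - ι a)) * h (ι d)
    reorder d = trans (ℤP.*-comm (h (ι d)) _) (cong (λ t → δ t * h (ι d)) (shift (ι a) (ι d) r))

  -- Summing over c: for b ≡ 0 every term is (K/p); otherwise c ↦ K - bc runs over all residues.
  sum-over-c : ∀ K b → (∑[ c < p ] legendre (K - ι b * ι c) p) ≡ δ (ι b) * (+ p * legendre K p)
  sum-over-c K b with divisible? (ι b)
  ... | yes p∣b = begin
    (∑[ c < p ] legendre (K - ι b * ι c) p) ≡⟨ ∑-cong {p} (λ c → legendre-respects (≋-by (∣-by (drop K (ι b * ι c)) (ℤD.∣m⇒∣-m (ℤD.∣m⇒∣m*n (ι c) p∣b))))) ⟩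
    (∑[ c < p ] legendre K p)               ≡⟨ ∑-const p (legendre K p) ⟩
    + p * legendre K p                      ≡⟨ ℤP.*-identityˡ _ ⟨
    + 1 * (+ p * legendre K p)              ≡⟨ cong (_* (+ p * legendre K p)) (δ-yes p∣b) ⟨
    δ (ι b) * (+ p * legendre K p)          ∎
    where
    open ≡-Reasoning
    drop : ∀ K s → - s ≡ (K - s) - K
    drop = solve-∀
  ... | no p∤b = begin
    (∑[ c < p ] legendre (K - ι b * ι c) p) ≡⟨ ∑-reindex≋ (λ c → K - ι b * c) injective (λ x → legendre x p) legendre-respects ⟩
    (∑[ z < p ] legendre (ι z) p)           ≡⟨ ∑-legendre≡0 ⟩
    + 0                                     ≡⟨ ℤP.*-zeroˡ (+ p * legendre K p) ⟨
    + 0 * (+ p * legendre K p)              ≡⟨ cong (_* (+ p * legendre K p)) (δ-no p∤b) ⟨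
    δ (ι b) * (+ p * legendre K p)          ∎
    where
    open ≡-Reasoning
    factor : ∀ K b x y → - ((K - b * x) - (K - b * y)) ≡ b * x - b * y
    factor = solve-∀
    injective : ∀ x y → K - ι b * x ≋ K - ι b * y → x ≋ y
    injective x y (≋-by p∣diff) = unit-injective p∤b x y (≋-by (∣-by (factor K (ι b) x y) (ℤD.∣m⇒∣-m p∣diff)))

  sum-over-b : ∀ X → (∑[ b < p ] (δ (ι b) * X)) ≡ X
  sum-over-b X = trans (sym (*-distribʳ-sum X (δ ∘ ι))) (trans (cong (_* X) ∑-δ₀) (ℤP.*-identityˡ X))

  traceSum≡p*jacobsthal : ∀ r → traceSum r ≡ + p * jacobsthal r
  traceSum≡p*jacobsthal r = begin
    traceSum r
      ≡⟨ ∑-cong {p} (λ a → ∑-cong {p} (λ b → ∑-cong {p} (λ c → sum-over-d r a b c))) ⟩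
    (∑[ a < p ] ∑[ b < p ] ∑[ c < p ] legendre (K a - ι b * ι c) p)
      ≡⟨ ∑-cong {p} (λ a → ∑-cong {p} (λ b → sum-over-c (K a) b)) ⟩
    (∑[ a < p ] ∑[ b < p ] (δ (ι b) * (+ p * legendre (K a) p)))
      ≡⟨ ∑-cong {p} (λ a → sum-over-b (+ p * legendre (K a) p)) ⟩
    (∑[ a < p ] (+ p * legendre (K a) p))
      ≡⟨ *-distribˡ-sum (+ p) (λ a → legendre (K a) p) ⟨
    + p * jacobsthal r ∎
    where
    open ≡-Reasoning
    K : Fin p → ℤ
    K a = ι a * (r - ι a)

  -- For r ≡ 0: a (r - a) ≡ -a², whose symbol is (-1/p) for a ≢ 0 and 0 for a ≡ 0.
  jacobsthal-divisible : ∀ {r} → p∣ r → jacobsthal r ≡ (+ p - + 1) * legendre (- + 1) p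
  jacobsthal-divisible {r} p∣r = begin
    jacobsthal r                                       ≡⟨ ∑-cong {p} term ⟩
    (∑[ a < p ] (L - δ (ι a) * L))                     ≡⟨ ∑-distrib-- (λ _ → L) (λ a → δ (ι a) * L) ⟩
    (∑[ a < p ] L) - (∑[ a < p ] (δ (ι a) * L))        ≡⟨ cong₂ _-_ (∑-const p L) (sum-over-b L) ⟩
    + p * L - L                                        ≡⟨ factor (+ p) L ⟩
    (+ p - + 1) * L                                    ∎
    where
    open ≡-Reasoning
    L = legendre (- + 1) p
    factor : ∀ n L → n * L - L ≡ (n - + 1) * L
    factor = solve-∀
    shift : ∀ a r → a * r ≡ a * (r - a) - a * a * - + 1
    shift = solve-∀
    term : ∀ a → legendre (ι a * (r - ι a)) p ≡ L - δ (ι a) * L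
    term a with divisible? (ι a)
    ... | yes p∣a = begin
      legendre (ι a * (r - ι a)) p  ≡⟨ legendre-respects (≋-by (∣-by (shift (ι a) r) (ℤD.∣n⇒∣m*n (ι a) p∣r))) ⟩
      legendre (ι a * ι a * - + 1) p ≡⟨ legendre-of-zero (ℤD.∣m⇒∣m*n (- + 1) (ℤD.∣m⇒∣m*n (ι a) p∣a)) ⟩
      + 0                           ≡⟨ cancel L ⟩
      L - + 1 * L                   ≡⟨ cong (λ t → L - t * L) (δ-yes p∣a) ⟨
      L - δ (ι a) * L               ∎
      where cancel : ∀ L → + 0 ≡ L - + 1 * L
            cancel = solve-∀
    ... | no p∤a = begin
      legendre (ι a * (r - ι a)) p  ≡⟨ legendre-respects (≋-by (∣-by (shift (ι a) r) (ℤD.∣n⇒∣m*n (ι a) p∣r))) ⟩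
      legendre (ι a * ι a * - + 1) p ≡⟨ legendre-unit-square (- + 1) p∤a ⟩
      L                             ≡⟨ keep L ⟩
      L - + 0 * L                   ≡⟨ cong (λ t → L - t * L) (δ-no p∤a) ⟨
      L - δ (ι a) * L               ∎
      where keep : ∀ L → L ≡ L - + 0 * L
            keep = solve-∀

  δ-off : ∀ {u r} → p∣ u → ¬ p∣ r → δ (u - r) ≡ + 0
  δ-off {u} {r} p∣u p∤r = δ-no λ p∣u-r → p∤r (∣-by (cancel u r) (ℤD.∣m∣n⇒∣m-n p∣u p∣u-r))
    where cancel : ∀ u r → u - (u - r) ≡ r
          cancel = solve-∀

  linear-solutions : ∀ {r} → ¬ p∣ r → ∀ m → (∑[ a < p ] δ (m * ι a - r)) ≡ + 1 - δ m
  linear-solutions {r} p∤r m with divisible? m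
  ... | yes p∣m = begin
    (∑[ a < p ] δ (m * ι a - r)) ≡⟨ ∑-cong {p} (λ a → δ-off (ℤD.∣m⇒∣m*n (ι a) p∣m) p∤r) ⟩
    (∑[ a < p ] (+ 0))           ≡⟨ sum-replicate-zero p ⟩
    + 1 - + 1                    ≡⟨ cong (_-_ (+ 1)) (δ-yes p∣m) ⟨
    + 1 - δ m                    ∎
    where open ≡-Reasoning
  ... | no p∤m = begin
    (∑[ a < p ] δ (m * ι a - r)) ≡⟨ ∑-reindex≋ (m *_) (unit-injective p∤m) (λ u → δ (u - r)) (δ-respects ∘ ≋-shift r) ⟩
    (∑[ z < p ] δ (ι z - r))     ≡⟨ ∑-δ r ⟩
    + 1 - + 0                    ≡⟨ cong (_-_ (+ 1)) (δ-no p∤m) ⟨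
    + 1 - δ m                    ∎
    where open ≡-Reasoning

  -- For a unit r: the square roots of a (r - a) are y = a k with (1 + k²) a ≡ r, plus y = 0 when a ≡ 0.
  roots-of-product : ∀ {r} → ¬ p∣ r → ∀ a → roots (a * (r - a)) ≡ δ a + (∑[ k < p ] δ ((+ 1 + ι k * ι k) * a - r))
  roots-of-product {r} p∤r a with divisible? a
  ... | yes p∣a = begin
    roots (a * (r - a))                                ≡⟨ roots-of-zero (ℤD.∣m⇒∣m*n (r - a) p∣a) ⟩
    + 1 + + 0                                          ≡⟨ cong₂ _+_ (δ-yes p∣a) (sum-replicate-zero p) ⟨
    δ a + (∑[ k < p ] (+ 0))                           ≡⟨ cong (_+_ (δ a)) (∑-cong {p} (λ k → δ-off (ℤD.∣n⇒∣m*n (+ 1 + ι k * ι k) p∣a) p∤r)) ⟨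
    δ a + (∑[ k < p ] δ ((+ 1 + ι k * ι k) * a - r))   ∎
    where open ≡-Reasoning
  ... | no p∤a = begin
    roots (a * (r - a))                                  ≡⟨ roots-rescale (a * (r - a)) p∤a ⟩
    (∑[ k < p ] δ ((a * ι k) * (a * ι k) - a * (r - a))) ≡⟨ ∑-cong {p} cancel-a ⟩
    (∑[ k < p ] δ ((+ 1 + ι k * ι k) * a - r))           ≡⟨ ℤP.+-identityˡ solutions ⟨
    + 0 + (∑[ k < p ] δ ((+ 1 + ι k * ι k) * a - r))     ≡⟨ cong (_+ solutions) (δ-no p∤a) ⟨
    δ a + (∑[ k < p ] δ ((+ 1 + ι k * ι k) * a - r))     ∎
    where
    open ≡-Reasoning
    factor : ∀ a k r → (a * k) * (a * k) - a * (r - a) ≡ a * ((+ 1 + k * k) * a - r)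
    factor = solve-∀
    solutions : ℤ
    solutions = ∑[ k < p ] δ ((+ 1 + ι k * ι k) * a - r)
    cancel-a : ∀ k → δ ((a * ι k) * (a * ι k) - a * (r - a)) ≡ δ ((+ 1 + ι k * ι k) * a - r)
    cancel-a k = trans (cong δ (factor a (ι k) r)) (δ-unit _ p∤a)

  ∑-roots-of-product : ∀ {r} → ¬ p∣ r → (∑[ a < p ] roots (ι a * (r - ι a))) ≡ + 1 + (+ p - roots (- + 1))
  ∑-roots-of-product {r} p∤r = begin
    (∑[ a < p ] roots (ι a * (r - ι a)))
      ≡⟨ ∑-cong {p} (λ a → roots-of-product p∤r (ι a)) ⟩
    (∑[ a < p ] (δ (ι a) + ∑[ k < p ] δ (m k * ι a - r)))
      ≡⟨ ∑-distrib-+ (δ ∘ ι) (λ a → ∑[ k < p ] δ (m k * ι a - r)) ⟩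
    (∑[ a < p ] δ (ι a)) + (∑[ a < p ] ∑[ k < p ] δ (m k * ι a - r))
      ≡⟨ cong₂ _+_ ∑-δ₀ (∑-comm (λ a k → δ (m k * ι a - r))) ⟩
    + 1 + (∑[ k < p ] ∑[ a < p ] δ (m k * ι a - r))
      ≡⟨ cong (_+_ (+ 1)) (∑-cong {p} (λ k → linear-solutions p∤r (m k))) ⟩
    + 1 + (∑[ k < p ] (+ 1 - δ (m k)))
      ≡⟨ cong (_+_ (+ 1)) (∑-distrib-- (λ _ → + 1) (δ ∘ m)) ⟩
    + 1 + ((∑[ k < p ] (+ 1)) - (∑[ k < p ] δ (m k)))
      ≡⟨ cong (_+_ (+ 1)) (cong₂ _-_ (trans (∑-const p (+ 1)) (ℤP.*-identityʳ (+ p))) (∑-cong {p} m≡square+1)) ⟩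
    + 1 + (+ p - roots (- + 1)) ∎
    where
    open ≡-Reasoning
    m : Fin p → ℤ
    m k = + 1 + ι k * ι k
    shift : ∀ s → + 1 + s ≡ s - - + 1
    shift = solve-∀
    m≡square+1 : ∀ k → δ (m k) ≡ δ (ι k * ι k - - + 1)
    m≡square+1 k = cong δ (shift (ι k * ι k))

  jacobsthal-unit : ∀ {r} → ¬ p∣ r → jacobsthal r ≡ - legendre (- + 1) p
  jacobsthal-unit {r} p∤r = begin
    jacobsthal r                                                   ≡⟨ ∑-cong {p} (λ a → legendre≡roots-1 (ι a * (r - ι a))) ⟩
    (∑[ a < p ] (roots (ι a * (r - ι a)) - + 1))                   ≡⟨ ∑-distrib-- (λ a → roots (ι a * (r - ι a))) (λ _ → + 1) ⟩
    (∑[ a < p ] roots (ι a * (r - ι a))) - (∑[ a < p ] (+ 1))      ≡⟨ cong₂ _-_ (∑-roots-of-product p∤r) (∑-const p (+ 1)) ⟩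
    + 1 + (+ p - roots (- + 1)) - + p * + 1                        ≡⟨ simplify (+ p) (roots (- + 1)) ⟩
    - (roots (- + 1) - + 1)                                        ≡⟨ cong -_ (legendre≡roots-1 (- + 1)) ⟨
    - legendre (- + 1) p                                           ∎
    where
    open ≡-Reasoning
    simplify : ∀ n w → + 1 + (n - w) - n * + 1 ≡ - (w - + 1)
    simplify = solve-∀

  counted : ℤ → ℤ → M₂ p → Bool
  counted s r σ = inGL₂ᵇ σ ∧ does (ψ p σ ℤ.≟ s) ∧ (p ∣ᵇ (tr σ - r))

  fiberCount-as-sum : ∀ s r → + fiberCount p s r ≡ ∑⁴ p (λ a b c d → ⟦ counted s r (a , b , c , d) ⟧)
  fiberCount-as-sum s r =
    trans (count-concatMap P id entries₁) (∑-cong {p} λ a →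
    trans (count-concatMap P id (entries₂ a)) (∑-cong {p} λ b →
    trans (count-concatMap P id (entries₃ a b)) (∑-cong {p} λ c →
    trans (count-concatMap P id (entries₄ a b c)) (∑-cong {p} λ d → count-singleton P (a , b , c , d)))))
    where
    P = counted s r
    entries₄ : Fin p → Fin p → Fin p → Fin p → List (M₂ p)
    entries₄ a b c d = (a , b , c , d) ∷ []
    entries₃ : Fin p → Fin p → Fin p → List (M₂ p)
    entries₃ a b c = concatMap (entries₄ a b c) (allFin p)
    entries₂ : Fin p → Fin p → List (M₂ p)
    entries₂ a b = concatMap (entries₃ a b) (allFin p)
    entries₁ : Fin p → List (M₂ p)
    entries₁ a = concatMap (entries₂ a) (allFin p)

  -- Each matrix contributes its Legendre symbol, and only if its trace is r.
  fiberCount-difference : ∀ r → + fiberCount p (+ 1) r - + fiberCount p (- (+ 1)) r ≡ traceSum r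
  fiberCount-difference r = begin
    + fiberCount p (+ 1) r - + fiberCount p (- (+ 1)) r
      ≡⟨ cong₂ _-_ (fiberCount-as-sum (+ 1) r) (fiberCount-as-sum (- (+ 1)) r) ⟩
    ∑⁴ p (λ a b c d → ⟦ counted (+ 1) r (a , b , c , d) ⟧) - ∑⁴ p (λ a b c d → ⟦ counted (- (+ 1)) r (a , b , c , d) ⟧)
      ≡⟨ ∑⁴-distrib-- (λ a b c d → ⟦ counted (+ 1) r (a , b , c , d) ⟧) (λ a b c d → ⟦ counted (- (+ 1)) r (a , b , c , d) ⟧) ⟨
    ∑⁴ p (λ a b c d → ⟦ counted (+ 1) r (a , b , c , d) ⟧ - ⟦ counted (- (+ 1)) r (a , b , c , d) ⟧)
      ≡⟨ ∑⁴-cong (λ a b c d → weight (a , b , c , d)) ⟩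
    traceSum r ∎
    where
    open ≡-Reasoning
    weight : ∀ σ → ⟦ counted (+ 1) r σ ⟧ - ⟦ counted (- (+ 1)) r σ ⟧ ≡ legendre (det σ) p * δ (tr σ - r)
    weight σ = trans (fibre-weight (p ∣ᵇ det σ) (any (is-root (det σ)) (allFin p)) (p ∣ᵇ (tr σ - r)))
                     (cong (_*_ (legendre (det σ) p)) (sym (δ≡⟦∣ᵇ⟧ (tr σ - r))))

lemma5p4 : (p : ℕ) → Prime p → p ≢ 2 → (r : ℤ) →
    ((p ∣ ∣ r ∣) → + fiberCount p (+ 1) r - + fiberCount p (- (+ 1)) r
        ≡ legendre (- (+ 1)) p * (+ p * (+ p - + 1)))
    × ((¬ (p ∣ ∣ r ∣)) → + fiberCount p (+ 1) r - + fiberCount p (- (+ 1)) r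
        ≡ - (legendre (- (+ 1)) p * + p))
lemma5p4 p p-prime p≢2 r = divisible-trace , unit-trace
  where
  open TraceSums p p-prime p≢2
  L = legendre (- (+ 1)) p

  difference : + fiberCount p (+ 1) r - + fiberCount p (- (+ 1)) r ≡ + p * jacobsthal r
  difference = trans (fiberCount-difference r) (traceSum≡p*jacobsthal r)

  divisible-trace : p ∣ ∣ r ∣ → + fiberCount p (+ 1) r - + fiberCount p (- (+ 1)) r ≡ L * (+ p * (+ p - + 1))
  divisible-trace p∣r = trans difference (trans (cong (_*_ (+ p)) (jacobsthal-divisible {r} (∣ᵤ⇒∣ p∣r))) (rearrange (+ p) L))
    where rearrange : ∀ n L → n * ((n - + 1) * L) ≡ L * (n * (n - + 1))
          rearrange = solve-∀

  unit-trace : ¬ (p ∣ ∣ r ∣) → + fiberCount p (+ 1) r - + fiberCount p (- (+ 1)) r ≡ - (L * + p)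
  unit-trace p∤r = trans difference (trans (cong (_*_ (+ p)) (jacobsthal-unit {r} (p∤r ∘ ∣⇒∣ᵤ))) (rearrange (+ p) L))
    where rearrange : ∀ n L → n * - L ≡ - (L * n)
          rearrange = solve-∀
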